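{- Let $n\ge 3$ and let $\Gamma$ be a connected simple graph of order $n$ with no bridges. Then $SO(\Gamma)\ge \sqrt{8}\,n$, with equality if and only if $\Gamma\cong C_n$.
   Context: The Sombor index of a graph $\Gamma$ is $SO(\Gamma)=\sum_{uv\in E(\Gamma)}\sqrt{\deg_\Gamma(u)^2+\deg_\Gamma(v)^2}$. A bridge is an edge whose deletion disconnects the graph. $C_n$ is the cycle on $n$ vertices. -}

module Defs where

open import Data.Bool using (Bool; true; false; if_then_else_; _∧_; _∨_; not)
open import Data.Nat using (ℕ; zero; suc; _+_; _*_; _∸_; _≡ᵇ_; _<ᵇ_)
open import Data.Fin using (Fin; toℕ)
import Data.Fin as F
open import Data.List using (List; []; _∷_; [_]; map; concatMap; foldr; replicate)
open import Data.Nat.ListAction using (sum)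
open import Data.List.Relation.Binary.Pointwise using (Pointwise)
open import Data.Integer using (+_)
open import Data.Rational using (ℚ; 0ℚ; _/_) renaming (_+_ to _+ℚ_; _*_ to _*ℚ_; _<_ to _<ℚ_)
open import Data.Product using (Σ; _×_; ∃)
open import Data.Sum using (_⊎_)
open import Relation.Nullary using (¬_)
open import Relation.Nullary.Decidable using (⌊_⌋)
open import Relation.Binary.PropositionalEquality using (_≡_)
open import Function.Bundles using (_↔_; Inverse)

record SimpleGraph (n : ℕ) : Set where
  field
    adj    : Fin n → Fin n → Bool
    sym    : ∀ i j → adj i j ≡ adj j i
    irrefl : ∀ i → adj i i ≡ false
open SimpleGraph public

allFin : (n : ℕ) → List (Fin n)
allFin n = Data.List.allFin n

deg : ∀ {n} → SimpleGraph n → Fin n → ℕ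
deg {n} G i = sum (map (λ j → if adj G i j then 1 else 0) (allFin n))

data Walk {n : ℕ} (a : Fin n → Fin n → Bool) : Fin n → Fin n → Set where
  here : ∀ {u} → Walk a u u
  step : ∀ {u w v} → a u w ≡ true → Walk a w v → Walk a u v

ConnectedAdj : ∀ {n} → (Fin n → Fin n → Bool) → Set
ConnectedAdj {n} a = ∀ (u v : Fin n) → Walk a u v

Connected : ∀ {n} → SimpleGraph n → Set
Connected G = ConnectedAdj (adj G)

deleteEdge : ∀ {n} → (Fin n → Fin n → Bool) → Fin n → Fin n → (Fin n → Fin n → Bool)
deleteEdge a u v x y =
  a x y ∧ not ((⌊ x F.≟ u ⌋ ∧ ⌊ y F.≟ v ⌋) ∨ (⌊ x F.≟ v ⌋ ∧ ⌊ y F.≟ u ⌋))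

IsBridge : ∀ {n} → SimpleGraph n → Fin n → Fin n → Set
IsBridge G u v = (adj G u v ≡ true) × ¬ ConnectedAdj (deleteEdge (adj G) u v)

NoBridges : ∀ {n} → SimpleGraph n → Set
NoBridges {n} G = ∀ (u v : Fin n) → ¬ IsBridge G u v

cycleAdj : (n : ℕ) → Fin n → Fin n → Bool
cycleAdj n i j = succ i j ∨ succ j i
  where
  succ : Fin n → Fin n → Bool
  succ x y = (toℕ y ≡ᵇ suc (toℕ x)) ∨ ((toℕ x ≡ᵇ n ∸ 1) ∧ (toℕ y ≡ᵇ 0))

IsoToCycle : ∀ {n} → SimpleGraph n → Set
IsoToCycle {n} G =
  Σ (Fin n ↔ Fin n) λ f →
    ∀ i j → adj G i j ≡ cycleAdj n (Inverse.to f i) (Inverse.to f j)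

-- Sums of square roots of naturals, as real numbers given by their
-- (open, Dedekind) lower cuts:
--   q < Σ √aᵢ  iff  q < Σ rᵢ for some rationals rᵢ with rᵢ < √aᵢ,
-- where r < √a  iff  r < 0 or r*r < a.

ℕtoℚ : ℕ → ℚ
ℕtoℚ a = (+ a) / 1

BelowSqrt : ℕ → ℚ → Set
BelowSqrt a r = (r <ℚ 0ℚ) ⊎ (r *ℚ r <ℚ ℕtoℚ a)

sumℚ : List ℚ → ℚ
sumℚ = foldr _+ℚ_ 0ℚ

BelowSqrtSum : List ℕ → ℚ → Set
BelowSqrtSum as q = ∃ λ (rs : List ℚ) → Pointwise BelowSqrt as rs × (q <ℚ sumℚ rs)

_≤√_ : List ℕ → List ℕ → Set
as ≤√ bs = ∀ q → BelowSqrtSum as q → BelowSqrtSum bs q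

_≈√_ : List ℕ → List ℕ → Set
as ≈√ bs = (as ≤√ bs) × (bs ≤√ as)

-- Sombor index: SO(G) = Σ_{uv ∈ E} √(deg u² + deg v²),
-- represented by the list of radicands, one per edge {u,v} (u < v).

somborTerms : ∀ {n} → SimpleGraph n → List ℕ
somborTerms {n} G =
  concatMap (λ u → concatMap (λ v →
      if adj G u v ∧ (toℕ u <ᵇ toℕ v)
      then [ deg G u * deg G u + deg G v * deg G v ]
      else []) (allFin n)) (allFin n)

sqrt8Times : ℕ → List ℕ
sqrt8Times n = replicate n 8

-- Without bridges, a connected graph on n ≥ 3 vertices has minimum degree 2: an isolated
-- vertex reaches nothing, and the edge at a leaf is a bridge. So every edge contributes at
-- least √(2² + 2²) = √8 and, by the handshake lemma, there are at least n edges. A vertex of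
-- degree ≥ 3 makes one term at least √13 > √8, so the index then strictly exceeds √8 n; this
-- is certified by rational approximations of √8 built from solutions of x² = 8y² + 1.
-- Equality therefore forces G to be 2-regular, and a connected 2-regular graph is a cycle:
-- the walk that never turns back first returns to its start after visiting every vertex once.
-- Conversely C_n is 2-regular, so all n of its terms equal √8.

module Submission where

open import Algebra.Bundles using (CommutativeMonoid)
import Algebra.Properties.CommutativeMonoid.Sum as MonoidSum
import Algebra.Properties.CommutativeSemigroup as CommutativeSemigroupProperties
open import Data.Bool using (Bool; true; false; T; if_then_else_; _∧_; _∨_; not)
import Data.Bool.Properties as Bool
open import Data.Empty using (⊥; ⊥-elim)
open import Data.Fin using (Fin; zero; suc; toℕ; fromℕ<)
import Data.Fin as Fin
import Data.Fin.Properties as Fin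
import Data.Integer as ℤ
import Data.Integer.Properties as ℤ
open import Data.List using (List; []; _∷_; [_]; map; tabulate; concatMap; length; replicate)
import Data.List.Properties as List
open import Data.List.Relation.Binary.Pointwise using (Pointwise; []; _∷_)
open import Data.List.Relation.Unary.All using (All; []; _∷_)
import Data.List.Relation.Unary.All.Properties as All
open import Data.List.Relation.Unary.Any using (Any)
import Data.List.Relation.Unary.Any.Properties as Any
open import Data.Nat
import Data.Nat.Coprimality as Coprime
import Data.Nat.ListAction as List
open import Data.Nat.Properties
open import Data.Nat.Tactic.RingSolver using (solve-∀)
open import Data.Product using (∃; _×_; _,_; proj₁; proj₂)
open import Data.Rational using (ℚ; 0ℚ; 1ℚ; mkℚ; Positive; NonNegative)
  renaming (_+_ to _+ℚ_; _*_ to _*ℚ_; _<_ to _<ℚ_; _≤_ to _≤ℚ_)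
import Data.Rational as ℚ
import Data.Rational.Properties as ℚ
import Data.Rational.Unnormalised as ℚᵘ
import Data.Rational.Unnormalised.Properties as ℚᵘ
open import Data.Sum using (_⊎_; inj₁; inj₂; [_,_]′)
import Data.Sum
open import Data.Sum.Function.Propositional using (_⊎-⇔_)
open import Function using (_∘_; id)
open import Function.Bundles using (_↔_; Inverse; _⇔_; mk⇔; Equivalence; mk↔ₛ′)
import Function.Properties.Equivalence as ⇔
open import Relation.Binary.Definitions using (tri<; tri≈; tri>)
open import Relation.Binary.PropositionalEquality hiding ([_])
open import Relation.Nullary using (¬_; Dec; yes; no; contradiction)
open import Relation.Nullary.Decidable using (⌊_⌋; isYes≗does; dec-true; _×-dec_)

open import Defs renaming (sym to adj-sym)

open MonoidSum +-0-commutativeMonoid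
  using (sum-cong-≗; sum-permute; ∑-distrib-+; ∑-comm) renaming (sum to ∑)
open CommutativeSemigroupProperties +-commutativeSemigroup using (x∙yz≈y∙xz)

private
  variable
    n : ℕ

true≢false : true ≢ false
true≢false ()

≡true⇔⇒≡ : ∀ {x y} → (x ≡ true → y ≡ true) → (y ≡ true → x ≡ true) → x ≡ y
≡true⇔⇒≡ {false} {false} _ _ = refl
≡true⇔⇒≡ {false} {true}  _ y⇒x = y⇒x refl
≡true⇔⇒≡ {true}  {_}     x⇒y _ = sym (x⇒y refl)

⌊≟⌋-refl : (i : Fin n) → ⌊ i Fin.≟ i ⌋ ≡ true
⌊≟⌋-refl i = trans (isYes≗does (i Fin.≟ i)) (dec-true (i Fin.≟ i) refl)

⌊≟⌋-suc : (i j : Fin n) → ⌊ suc i Fin.≟ suc j ⌋ ≡ ⌊ i Fin.≟ j ⌋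
⌊≟⌋-suc i j with i Fin.≟ j
... | yes _ = refl
... | no _ = refl

indicator : Bool → ℕ
indicator b = if b then 1 else 0

count : (Fin n → Bool) → ℕ
count p = ∑ (indicator ∘ p)

sum-map-tabulate : ∀ {A : Set} n (f : A → ℕ) (g : Fin n → A) →
  List.sum (map f (tabulate g)) ≡ ∑ (f ∘ g)
sum-map-tabulate zero    f g = refl
sum-map-tabulate (suc n) f g = cong (f (g zero) +_) (sum-map-tabulate n f (g ∘ suc))

count-cong : {p q : Fin n → Bool} → (∀ j → p j ≡ q j) → count p ≡ count q
count-cong p≗q = sum-cong-≗ (cong indicator ∘ p≗q)

count-permute : (p : Fin n → Bool) (π : Fin n ↔ Fin n) →
  count (p ∘ Inverse.to π) ≡ count p
count-permute p π = sym (sum-permute (indicator ∘ p) π)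

_∖_ : (Fin n → Bool) → Fin n → Fin n → Bool
(p ∖ a) j = p j ∧ not ⌊ j Fin.≟ a ⌋

∖-true : (p : Fin n → Bool) {a b : Fin n} → p b ≡ true → b ≢ a → (p ∖ a) b ≡ true
∖-true p {a} {b} pb b≢a with b Fin.≟ a
... | yes b≡a = contradiction b≡a b≢a
... | no _ rewrite pb = refl

∖-sound : (p : Fin n → Bool) {a j : Fin n} → (p ∖ a) j ≡ true → p j ≡ true × j ≢ a
∖-sound p {a} {j} e with p j | j Fin.≟ a
... | true  | no j≢a = refl , j≢a

count-∖-suc : (p : Fin (suc n) → Bool) (a : Fin n) →
  count ((p ∘ suc) ∖ a) ≡ count ((p ∖ suc a) ∘ suc)
count-∖-suc p a = count-cong λ j → cong (λ b → p (suc j) ∧ not b) (sym (⌊≟⌋-suc j a))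

count-∖ : (p : Fin n → Bool) (a : Fin n) → p a ≡ true → count p ≡ suc (count (p ∖ a))
count-∖ p zero pa with p zero
... | true = cong suc (count-cong λ j → sym (Bool.∧-identityʳ (p (suc j))))
count-∖ p (suc a) pa with p zero
... | true  = cong suc (trans (count-∖ (p ∘ suc) a pa) (cong suc (count-∖-suc p a)))
... | false = trans (count-∖ (p ∘ suc) a pa) (cong suc (count-∖-suc p a))

count≡0⇒false : (p : Fin n → Bool) → count p ≡ 0 → ∀ j → p j ≡ false
count≡0⇒false p c j with p j in pj
... | false = refl
... | true  = contradiction (trans (sym c) (count-∖ p j pj)) λ ()

count≡0 : (p : Fin n → Bool) → (∀ j → p j ≡ false) → count p ≡ 0
count≡0 {zero}  p p≡false = refl
count≡0 {suc n} p p≡false rewrite p≡false zero = count≡0 (p ∘ suc) (p≡false ∘ suc)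

count>0⇒∃ : (p : Fin n → Bool) → 0 < count p → ∃ λ j → p j ≡ true
count>0⇒∃ {suc n} p c with p zero in p0
... | true  = zero , p0
... | false = let j , pj = count>0⇒∃ (p ∘ suc) c in suc j , pj

count≥2 : (p : Fin n → Bool) {a b : Fin n} → p a ≡ true → p b ≡ true → a ≢ b → 2 ≤ count p
count≥2 p {a} {b} pa pb a≢b
  rewrite count-∖ p a pa | count-∖ (p ∖ a) b (∖-true p pb (a≢b ∘ sym))
  = s≤s (s≤s z≤n)

count≥3 : (p : Fin n → Bool) {a b c : Fin n} → p a ≡ true → p b ≡ true → p c ≡ true →
  a ≢ b → a ≢ c → b ≢ c → 3 ≤ count p
count≥3 p {a} {b} {c} pa pb pc a≢b a≢c b≢c
  rewrite count-∖ p a pa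
        | count-∖ (p ∖ a) b (∖-true p pb (a≢b ∘ sym))
        | count-∖ ((p ∖ a) ∖ b) c (∖-true (p ∖ a) (∖-true p pc (a≢c ∘ sym)) (b≢c ∘ sym))
  = s≤s (s≤s (s≤s z≤n))

count≥2⇒∃₂ : (p : Fin n → Bool) → 2 ≤ count p →
  ∃ λ a → ∃ λ b → p a ≡ true × p b ≡ true × a ≢ b
count≥2⇒∃₂ p c with count>0⇒∃ p (≤-trans (s≤s z≤n) c)
... | a , pa with count>0⇒∃ (p ∖ a) (≤-pred (subst (2 ≤_) (count-∖ p a pa) c))
... | b , p∖a[b] = let pb , b≢a = ∖-sound p p∖a[b] in a , b , pa , pb , b≢a ∘ sym

count≡1⇒unique : (p : Fin n → Bool) → count p ≡ 1 →
  ∀ {a w} → p a ≡ true → p w ≡ true → w ≡ a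
count≡1⇒unique p c {a} {w} pa pw with w Fin.≟ a
... | yes w≡a = w≡a
... | no  w≢a = contradiction (subst (2 ≤_) c (count≥2 p pw pa w≢a)) λ { (s≤s ()) }

count≡2⇒covered : (p : Fin n → Bool) → count p ≡ 2 →
  ∀ {a b w} → p a ≡ true → p b ≡ true → a ≢ b → p w ≡ true → w ≡ a ⊎ w ≡ b
count≡2⇒covered p c {a} {b} {w} pa pb a≢b pw with w Fin.≟ a | w Fin.≟ b
... | yes w≡a | _       = inj₁ w≡a
... | no  _   | yes w≡b = inj₂ w≡b
... | no  w≢a | no  w≢b =
  contradiction (subst (3 ≤_) c (count≥3 p pa pb pw a≢b (w≢a ∘ sym) (w≢b ∘ sym))) λ { (s≤s (s≤s ())) }

count≡2 : (p : Fin n → Bool) {a b : Fin n} → p a ≡ true → p b ≡ true → a ≢ b →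
  (∀ j → p j ≡ true → j ≡ a ⊎ j ≡ b) → count p ≡ 2
count≡2 p {a} {b} pa pb a≢b covered
  rewrite count-∖ p a pa | count-∖ (p ∖ a) b (∖-true p pb (a≢b ∘ sym))
  = cong (2 +_) (count≡0 ((p ∖ a) ∖ b) rest)
  where
  rest : ∀ j → ((p ∖ a) ∖ b) j ≡ false
  rest j with ((p ∖ a) ∖ b) j in e
  ... | false = refl
  ... | true with ∖-sound (p ∖ a) e
  ... | p∖a[j] , j≢b with ∖-sound p p∖a[j]
  ... | pj , j≢a = ⊥-elim ([ j≢a , j≢b ]′ (covered j pj))

∑-lower : ∀ {c} (f : Fin n → ℕ) → (∀ i → c ≤ f i) → n * c ≤ ∑ f
∑-lower {zero}  f c≤f = z≤n
∑-lower {suc n} f c≤f = +-mono-≤ (c≤f zero) (∑-lower (f ∘ suc) (c≤f ∘ suc))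

∑-const : ∀ {c} (f : Fin n → ℕ) → (∀ i → f i ≡ c) → ∑ f ≡ n * c
∑-const {zero}  f f≡c = refl
∑-const {suc n} f f≡c = cong₂ _+_ (f≡c zero) (∑-const (f ∘ suc) (f≡c ∘ suc))

adj-sym-true : (G : SimpleGraph n) {u v : Fin n} → adj G u v ≡ true → adj G v u ≡ true
adj-sym-true G {u} {v} uv = trans (adj-sym G v u) uv

adj⇒≢ : (G : SimpleGraph n) {u v : Fin n} → adj G u v ≡ true → u ≢ v
adj⇒≢ G {u} uv refl = true≢false (trans (sym uv) (irrefl G u))

deg≡count : (G : SimpleGraph n) (u : Fin n) → deg G u ≡ count (adj G u)
deg≡count {n} G u = sum-map-tabulate n (indicator ∘ adj G u) id

walk-from-isolated : (a : Fin n → Fin n → Bool) {u v : Fin n} →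
  (∀ w → a u w ≡ false) → Walk a u v → u ≡ v
walk-from-isolated a isolated here = refl
walk-from-isolated a isolated (step {w = w} uw _) = contradiction (trans (sym uw) (isolated w)) true≢false

deleteEdge-isolates : (a : Fin n → Fin n → Bool) (u v : Fin n) →
  (∀ {w} → a u w ≡ true → w ≡ v) → ∀ w → deleteEdge a u v u w ≡ false
deleteEdge-isolates a u v only-v w with a u w in uw
... | false = refl
... | true rewrite only-v uw | ⌊≟⌋-refl u | ⌊≟⌋-refl v = refl

∃-≢ : 2 ≤ n → (u : Fin n) → ∃ λ v → v ≢ u
∃-≢ {suc zero}    (s≤s ()) zero
∃-≢ {suc (suc _)} _ zero    = suc zero , λ ()
∃-≢ {suc (suc _)} _ (suc u) = zero , λ ()

bridgeless⇒deg≥2 : 2 ≤ n → (G : SimpleGraph n) → Connected G → NoBridges G → ∀ u → 2 ≤ deg G u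
bridgeless⇒deg≥2 n≥2 G conn bridgeless u rewrite deg≡count G u with count (adj G u) in c
... | suc (suc _) = s≤s (s≤s z≤n)
... | zero =
  let v , v≢u = ∃-≢ n≥2 u
  in ⊥-elim (v≢u (sym (walk-from-isolated (adj G) (count≡0⇒false (adj G u) c) (conn u v))))
... | suc zero with count>0⇒∃ (adj G u) (subst (0 <_) (sym c) (s≤s z≤n))
... | v , uv = ⊥-elim (bridgeless u v (uv , λ conn-uv → adj⇒≢ G uv
  (walk-from-isolated _ (deleteEdge-isolates (adj G) u v (count≡1⇒unique (adj G u) c uv)) (conn-uv u v))))

radicand : SimpleGraph n → Fin n → Fin n → ℕ
radicand G u v = deg G u * deg G u + deg G v * deg G v

orientedAdj : SimpleGraph n → Fin n → Fin n → Bool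
orientedAdj G u v = adj G u v ∧ (toℕ u <ᵇ toℕ v)

<ᵇ-true : ∀ {m k} → m < k → (m <ᵇ k) ≡ true
<ᵇ-true m<k = Equivalence.to Bool.T-≡ (<⇒<ᵇ m<k)

<ᵇ-false : ∀ {m k} → ¬ m < k → (m <ᵇ k) ≡ false
<ᵇ-false {m} {k} m≮k with m <ᵇ k in e
... | false = refl
... | true  = contradiction (<ᵇ⇒< m k (Equivalence.from Bool.T-≡ e)) m≮k

All-if : ∀ {A : Set} {P : A → Set} b {t : A} → (b ≡ true → P t) → All P (if b then [ t ] else [])
All-if true  Pt = Pt refl ∷ []
All-if false Pt = []

Any-if : ∀ {A : Set} {P : A → Set} {b} {t : A} → b ≡ true → P t → Any P (if b then [ t ] else [])
Any-if refl Pt = Any.here Pt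

All-concatMap-allFin : ∀ {A : Set} {P : A → Set} (f : Fin n → List A) →
  (∀ i → All P (f i)) → All P (concatMap f (allFin n))
All-concatMap-allFin f h = All.concat⁺ (All.map⁺ (All.tabulate⁺ h))

Any-concatMap-allFin : ∀ {A : Set} {P : A → Set} (f : Fin n → List A) i →
  Any P (f i) → Any P (concatMap f (allFin n))
Any-concatMap-allFin f i h = Any.concat⁺ (Any.map⁺ (Any.tabulate⁺ i h))

All-somborTerms : (G : SimpleGraph n) (P : ℕ → Set) →
  (∀ {u v} → adj G u v ≡ true → P (radicand G u v)) → All P (somborTerms G)
All-somborTerms G P h = All-concatMap-allFin _ λ u → All-concatMap-allFin _ λ v →
  All-if (orientedAdj G u v) (λ e → h (Bool.∧-conicalˡ _ _ e))

Any-somborTerms : (G : SimpleGraph n) (P : ℕ → Set) {u v : Fin n} →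
  adj G u v ≡ true → P (radicand G u v) → Any P (somborTerms G)
Any-somborTerms G P {u} {v} uv Puv with <-cmp (toℕ u) (toℕ v)
... | tri< u<v _ _ = Any-concatMap-allFin _ u (Any-concatMap-allFin _ v
      (Any-if (cong₂ _∧_ uv (<ᵇ-true u<v)) Puv))
... | tri≈ _ u≡v _ = contradiction (Fin.toℕ-injective u≡v) (adj⇒≢ G uv)
... | tri> _ _ v<u = Any-concatMap-allFin _ v (Any-concatMap-allFin _ u
      (Any-if (cong₂ _∧_ (adj-sym-true G uv) (<ᵇ-true v<u))
              (subst P (+-comm (deg G u * deg G u) _) Puv)))

length-concatMap-tabulate : ∀ {A B : Set} n (f : A → List B) (g : Fin n → A) →
  length (concatMap f (tabulate g)) ≡ ∑ (length ∘ f ∘ g)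
length-concatMap-tabulate zero    f g = refl
length-concatMap-tabulate (suc n) f g =
  trans (List.length-++ (f (g zero))) (cong (length (f (g zero)) +_) (length-concatMap-tabulate n f (g ∘ suc)))

size : SimpleGraph n → ℕ
size G = length (somborTerms G)

size≡∑∑ : (G : SimpleGraph n) →
  size G ≡ ∑ λ u → ∑ λ v → indicator (orientedAdj G u v)
size≡∑∑ {n} G =
  trans (length-concatMap-tabulate n _ id) (sum-cong-≗ λ u →
  trans (length-concatMap-tabulate n _ id) (sum-cong-≗ λ v →
  length-if (orientedAdj G u v)))
  where
  length-if : ∀ b {t : ℕ} → length (if b then [ t ] else []) ≡ indicator b
  length-if true  = refl
  length-if false = refl

-- Each edge {u, v} is counted once, in the orientation with toℕ u < toℕ v.
adj-indicator-split : (G : SimpleGraph n) (u v : Fin n) →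
  indicator (adj G u v) ≡ indicator (orientedAdj G u v) + indicator (orientedAdj G v u)
adj-indicator-split G u v with <-cmp (toℕ u) (toℕ v)
... | tri< u<v _ v≮u rewrite <ᵇ-true u<v | <ᵇ-false v≮u
                           | Bool.∧-identityʳ (adj G u v) | Bool.∧-zeroʳ (adj G v u) =
  sym (+-identityʳ _)
... | tri> u≮v _ v<u rewrite <ᵇ-true v<u | <ᵇ-false u≮v
                           | Bool.∧-identityʳ (adj G v u) | Bool.∧-zeroʳ (adj G u v)
                           | adj-sym G u v = refl
... | tri≈ _ u≡v _ with Fin.toℕ-injective u≡v
... | refl rewrite irrefl G u = refl

handshake : (G : SimpleGraph n) → ∑ (deg G) ≡ 2 * size G
handshake {n} G = begin
  ∑ (deg G)                                ≡⟨ sum-cong-≗ (deg≡count G) ⟩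
  ∑ (λ u → ∑ λ v → indicator (adj G u v))  ≡⟨ sum-cong-≗ (λ u → sum-cong-≗ (adj-indicator-split G u)) ⟩
  ∑ (λ u → ∑ λ v → E u v + E v u)          ≡⟨ sum-cong-≗ (λ u → ∑-distrib-+ (E u) (λ v → E v u)) ⟩
  ∑ (λ u → ∑ (E u) + ∑ λ v → E v u)        ≡⟨ ∑-distrib-+ (∑ ∘ E) (λ u → ∑ λ v → E v u) ⟩
  ∑ (∑ ∘ E) + ∑ (λ u → ∑ λ v → E v u)      ≡⟨ cong (∑ (∑ ∘ E) +_) (∑-comm (λ u v → E v u)) ⟩
  ∑ (∑ ∘ E) + ∑ (∑ ∘ E)                    ≡⟨ cong₂ _+_ (sym (size≡∑∑ G)) (sym (trans (+-identityʳ _) (size≡∑∑ G))) ⟩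
  2 * size G                               ∎
  where
  open ≡-Reasoning
  E : Fin n → Fin n → ℕ
  E u v = indicator (orientedAdj G u v)

order≤size : (G : SimpleGraph n) → (∀ u → 2 ≤ deg G u) → n ≤ size G
order≤size {n} G deg≥2 = *-cancelˡ-≤ 2 (begin
  2 * n      ≡⟨ *-comm 2 n ⟩
  n * 2      ≤⟨ ∑-lower (deg G) deg≥2 ⟩
  ∑ (deg G)  ≡⟨ handshake G ⟩
  2 * size G ∎)
  where open ≤-Reasoning

size≡order : (G : SimpleGraph n) → (∀ u → deg G u ≡ 2) → size G ≡ n
size≡order {n} G deg≡2 = *-cancelˡ-≡ (size G) n 2 (begin
  2 * size G ≡⟨ handshake G ⟨
  ∑ (deg G)  ≡⟨ ∑-const (deg G) deg≡2 ⟩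
  n * 2      ≡⟨ *-comm n 2 ⟩
  2 * n      ∎)
  where open ≡-Reasoning

ℕtoℚ≡mkℚ : ∀ a → ℕtoℚ a ≡ mkℚ (ℤ.+ a) 0 (Coprime.sym (Coprime.1-coprimeTo a))
ℕtoℚ≡mkℚ a = ℚ.normalize-coprime (Coprime.sym (Coprime.1-coprimeTo a))

toℚᵘ-ℕtoℚ : ∀ a → ℚ.toℚᵘ (ℕtoℚ a) ≡ ℚᵘ.mkℚᵘ (ℤ.+ a) 0
toℚᵘ-ℕtoℚ a rewrite ℕtoℚ≡mkℚ a = refl

ℕtoℚ-+ : ∀ a b → ℕtoℚ (a + b) ≡ ℕtoℚ a +ℚ ℕtoℚ b
ℕtoℚ-+ a b = ℚ.toℚᵘ-injective (ℚᵘ.≃-trans embedded (ℚᵘ.≃-sym (ℚ.toℚᵘ-homo-+ (ℕtoℚ a) (ℕtoℚ b))))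
  where
  open ≡-Reasoning
  embedded : ℚ.toℚᵘ (ℕtoℚ (a + b)) ℚᵘ.≃ (ℚ.toℚᵘ (ℕtoℚ a) ℚᵘ.+ ℚ.toℚᵘ (ℕtoℚ b))
  embedded rewrite toℚᵘ-ℕtoℚ (a + b) | toℚᵘ-ℕtoℚ a | toℚᵘ-ℕtoℚ b = ℚᵘ.*≡* (begin
    ℤ.+ (a + b) ℤ.* ℤ.+ 1                            ≡⟨ ℤ.*-identityʳ _ ⟩
    ℤ.+ (a + b)                                      ≡⟨ ℤ.pos-+ a b ⟩
    ℤ.+ a ℤ.+ ℤ.+ b                                  ≡⟨ cong₂ ℤ._+_ (ℤ.*-identityʳ (ℤ.+ a)) (ℤ.*-identityʳ (ℤ.+ b)) ⟨
    ℤ.+ a ℤ.* ℤ.+ 1 ℤ.+ ℤ.+ b ℤ.* ℤ.+ 1              ≡⟨ ℤ.*-identityʳ _ ⟨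
    (ℤ.+ a ℤ.* ℤ.+ 1 ℤ.+ ℤ.+ b ℤ.* ℤ.+ 1) ℤ.* ℤ.+ 1  ∎)

ℕtoℚ-* : ∀ a b → ℕtoℚ (a * b) ≡ ℕtoℚ a *ℚ ℕtoℚ b
ℕtoℚ-* a b = ℚ.toℚᵘ-injective (ℚᵘ.≃-trans embedded (ℚᵘ.≃-sym (ℚ.toℚᵘ-homo-* (ℕtoℚ a) (ℕtoℚ b))))
  where
  open ≡-Reasoning
  embedded : ℚ.toℚᵘ (ℕtoℚ (a * b)) ℚᵘ.≃ (ℚ.toℚᵘ (ℕtoℚ a) ℚᵘ.* ℚ.toℚᵘ (ℕtoℚ b))
  embedded rewrite toℚᵘ-ℕtoℚ (a * b) | toℚᵘ-ℕtoℚ a | toℚᵘ-ℕtoℚ b = ℚᵘ.*≡* (begin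
    ℤ.+ (a * b) ℤ.* ℤ.+ 1        ≡⟨ ℤ.*-identityʳ _ ⟩
    ℤ.+ (a * b)                  ≡⟨ ℤ.pos-* a b ⟩
    ℤ.+ a ℤ.* ℤ.+ b              ≡⟨ ℤ.*-identityʳ _ ⟨
    (ℤ.+ a ℤ.* ℤ.+ b) ℤ.* ℤ.+ 1  ∎)

ℕtoℚ-mono-< : ∀ {a b} → a < b → ℕtoℚ a <ℚ ℕtoℚ b
ℕtoℚ-mono-< {a} {b} a<b = ℚ.toℚᵘ-cancel-< (subst₂ ℚᵘ._<_ (sym (toℚᵘ-ℕtoℚ a)) (sym (toℚᵘ-ℕtoℚ b))
  (ℚᵘ.*<* (subst₂ ℤ._<_ (sym (ℤ.*-identityʳ (ℤ.+ a))) (sym (ℤ.*-identityʳ (ℤ.+ b))) (ℤ.+<+ a<b))))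

ℕtoℚ-mono-≤ : ∀ {a b} → a ≤ b → ℕtoℚ a ≤ℚ ℕtoℚ b
ℕtoℚ-mono-≤ {a} {b} a≤b = ℚ.toℚᵘ-cancel-≤ (subst₂ ℚᵘ._≤_ (sym (toℚᵘ-ℕtoℚ a)) (sym (toℚᵘ-ℕtoℚ b))
  (ℚᵘ.*≤* (subst₂ ℤ._≤_ (sym (ℤ.*-identityʳ (ℤ.+ a))) (sym (ℤ.*-identityʳ (ℤ.+ b))) (ℤ.+≤+ a≤b))))

square-mono-≤ : ∀ {c r} → 0ℚ ≤ℚ c → c ≤ℚ r → c *ℚ c ≤ℚ r *ℚ r
square-mono-≤ {c} {r} 0≤c c≤r = ℚ.≤-trans (ℚ.*-monoˡ-≤-nonNeg c c≤r) (ℚ.*-monoʳ-≤-nonNeg r c≤r)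
  where
  instance
    c≥0 : NonNegative c
    c≥0 = ℚ.nonNegative 0≤c
    r≥0 : NonNegative r
    r≥0 = ℚ.nonNegative (ℚ.≤-trans 0≤c c≤r)

BelowSqrt-mono : ∀ {a b r} → a ≤ b → BelowSqrt a r → BelowSqrt b r
BelowSqrt-mono a≤b (inj₁ r<0)  = inj₁ r<0
BelowSqrt-mono a≤b (inj₂ r²<a) = inj₂ (ℚ.<-≤-trans r²<a (ℕtoℚ-mono-≤ a≤b))

0-BelowSqrt : ∀ {a} → 1 ≤ a → BelowSqrt a 0ℚ
0-BelowSqrt a≥1 = inj₂ (ℚ.<-≤-trans (ℕtoℚ-mono-< {0} {1} (s≤s z≤n)) (ℕtoℚ-mono-≤ a≥1))

BelowSqrt⇒≤ : ∀ {a r c} → 0ℚ ≤ℚ c → ℕtoℚ a ≤ℚ c *ℚ c → BelowSqrt a r → r ≤ℚ c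
BelowSqrt⇒≤ 0≤c a≤c² (inj₁ r<0) = ℚ.<⇒≤ (ℚ.<-≤-trans r<0 0≤c)
BelowSqrt⇒≤ {a} {r} {c} 0≤c a≤c² (inj₂ r²<a) with r ℚ.≤? c
... | yes r≤c = r≤c
... | no  r≰c = contradiction
  (ℚ.<-≤-trans r²<a (ℚ.≤-trans a≤c² (square-mono-≤ 0≤c (ℚ.<⇒≤ (ℚ.≰⇒> r≰c)))))
  (ℚ.<-irrefl refl)

sumℚ-replicate-0 : ∀ k → sumℚ (replicate k 0ℚ) ≡ 0ℚ
sumℚ-replicate-0 zero    = refl
sumℚ-replicate-0 (suc k) = trans (ℚ.+-identityˡ _) (sumℚ-replicate-0 k)

-- Witnesses for the n copies of √a bound the first n terms of ts; the remaining terms get 0.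
replicate-≤√ : ∀ {a} n ts → 1 ≤ a → n ≤ length ts → All (a ≤_) ts → replicate n a ≤√ ts
replicate-≤√ {a} n ts a≥1 n≤len a≤ts q (rs , rs<√a , q<Σrs) =
  let rs′ , rs′<√ts , Σrs′≡Σrs = extend n ts rs n≤len a≤ts rs<√a
  in rs′ , rs′<√ts , subst (q <ℚ_) (sym Σrs′≡Σrs) q<Σrs
  where
  zeros<√ts : ∀ ts → All (a ≤_) ts → Pointwise BelowSqrt ts (replicate (length ts) 0ℚ)
  zeros<√ts []       []             = []
  zeros<√ts (t ∷ ts) (a≤t ∷ a≤ts) = 0-BelowSqrt (≤-trans a≥1 a≤t) ∷ zeros<√ts ts a≤ts

  extend : ∀ n ts rs → n ≤ length ts → All (a ≤_) ts → Pointwise BelowSqrt (replicate n a) rs →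
    ∃ λ rs′ → Pointwise BelowSqrt ts rs′ × sumℚ rs′ ≡ sumℚ rs
  extend zero ts [] _ a≤ts [] = _ , zeros<√ts ts a≤ts , sumℚ-replicate-0 (length ts)
  extend (suc n) (t ∷ ts) (r ∷ rs) (s≤s n≤len) (a≤t ∷ a≤ts) (r<√a ∷ rs<√a) =
    let rs′ , rs′<√ts , Σrs′≡Σrs = extend n ts rs n≤len a≤ts rs<√a
    in r ∷ rs′ , BelowSqrt-mono a≤t r<√a ∷ rs′<√ts , cong (r +ℚ_) Σrs′≡Σrs

module Scaled (D : ℕ) .{{_ : NonZero D}} where

  open CommutativeSemigroupProperties (CommutativeMonoid.commutativeSemigroup ℚ.*-1-commutativeMonoid)
    using (interchange)

  instance
    D>0 : Positive (ℕtoℚ D)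
    D>0 = ℚ.positive (ℕtoℚ-mono-< (>-nonZero⁻¹ D))
    D≢0 : ℚ.NonZero (ℕtoℚ D)
    D≢0 = ℚ.pos⇒nonZero (ℕtoℚ D)

  e : ℚ
  e = ℚ.1/ ℕtoℚ D

  De≡1 : ℕtoℚ D *ℚ e ≡ 1ℚ
  De≡1 = ℚ.*-inverseʳ (ℕtoℚ D)

  instance
    e>0 : Positive e
    e>0 = ℚ.1/pos⇒pos (ℕtoℚ D)
    e≥0 : NonNegative e
    e≥0 = ℚ.pos⇒nonNeg e
    e²>0 : Positive (e *ℚ e)
    e²>0 = ℚ.pos*pos⇒pos e e

  scaled : ℕ → ℚ
  scaled A = ℕtoℚ A *ℚ e

  scaled-square : ∀ A → scaled A *ℚ scaled A ≡ ℕtoℚ (A * A) *ℚ (e *ℚ e)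
  scaled-square A = trans (interchange (ℕtoℚ A) e (ℕtoℚ A) e) (cong (_*ℚ (e *ℚ e)) (sym (ℕtoℚ-* A A)))

  unscaled : ∀ t → ℕtoℚ t ≡ ℕtoℚ (t * (D * D)) *ℚ (e *ℚ e)
  unscaled t = begin
    ℕtoℚ t                                    ≡⟨ ℚ.*-identityʳ (ℕtoℚ t) ⟨
    ℕtoℚ t *ℚ 1ℚ                              ≡⟨ cong (ℕtoℚ t *ℚ_) (cong₂ _*ℚ_ De≡1 De≡1) ⟨
    ℕtoℚ t *ℚ (scaled D *ℚ scaled D)          ≡⟨ cong (ℕtoℚ t *ℚ_) (scaled-square D) ⟩
    ℕtoℚ t *ℚ (ℕtoℚ (D * D) *ℚ (e *ℚ e))      ≡⟨ ℚ.*-assoc (ℕtoℚ t) _ _ ⟨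
    ℕtoℚ t *ℚ ℕtoℚ (D * D) *ℚ (e *ℚ e)        ≡⟨ cong (_*ℚ (e *ℚ e)) (ℕtoℚ-* t (D * D)) ⟨
    ℕtoℚ (t * (D * D)) *ℚ (e *ℚ e)            ∎
    where open ≡-Reasoning

  scaled≥0 : ∀ X → 0ℚ ≤ℚ scaled X
  scaled≥0 X = subst (_≤ℚ scaled X) (ℚ.*-zeroˡ e) (ℚ.*-monoʳ-≤-nonNeg e (ℕtoℚ-mono-≤ {0} {X} z≤n))

  scaled-BelowSqrt : ∀ {A t} → A * A < t * (D * D) → BelowSqrt t (scaled A)
  scaled-BelowSqrt {A} {t} A²<tD² = inj₂ (subst₂ _<ℚ_ (sym (scaled-square A)) (sym (unscaled t))
    (ℚ.*-monoˡ-<-pos (e *ℚ e) (ℕtoℚ-mono-< A²<tD²)))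

  BelowSqrt⇒≤scaled : ∀ {X t r} → t * (D * D) ≤ X * X → BelowSqrt t r → r ≤ℚ scaled X
  BelowSqrt⇒≤scaled {X} {t} tD²≤X² = BelowSqrt⇒≤ {t} (scaled≥0 X)
    (subst₂ _≤ℚ_ (sym (unscaled t)) (sym (scaled-square X))
      (ℚ.*-monoʳ-≤-nonNeg (e *ℚ e) {{ℚ.pos⇒nonNeg (e *ℚ e)}} (ℕtoℚ-mono-≤ tD²≤X²)))

  scaled-+ : ∀ a b → scaled a +ℚ scaled b ≡ scaled (a + b)
  scaled-+ a b = trans (sym (ℚ.*-distribʳ-+ e (ℕtoℚ a) (ℕtoℚ b))) (cong (_*ℚ e) (sym (ℕtoℚ-+ a b)))

  sumℚ-scaled : ∀ ks → sumℚ (map scaled ks) ≡ scaled (List.sum ks)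
  sumℚ-scaled []       = sym (ℚ.*-zeroˡ e)
  sumℚ-scaled (k ∷ ks) = trans (cong (scaled k +ℚ_) (sumℚ-scaled ks)) (scaled-+ k (List.sum ks))

  sumℚ-BelowSqrt-≤ : ∀ {X t} n rs → t * (D * D) ≤ X * X →
    Pointwise BelowSqrt (replicate n t) rs → sumℚ rs ≤ℚ scaled (n * X)
  sumℚ-BelowSqrt-≤ zero [] tD²≤X² [] = ℚ.≤-reflexive (sym (ℚ.*-zeroˡ e))
  sumℚ-BelowSqrt-≤ {X} {t} (suc n) (r ∷ rs) tD²≤X² (r<√t ∷ rs<√t) = ℚ.≤-trans
    (ℚ.+-mono-≤ (BelowSqrt⇒≤scaled {X} {t} tD²≤X² r<√t) (sumℚ-BelowSqrt-≤ {X} {t} n rs tD²≤X² rs<√t))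
    (ℚ.≤-reflexive (scaled-+ X (n * X)))

weight : (c A B t : ℕ) → ℕ
weight c A B t = if c ≤ᵇ t then A else B

module _ (c : ℕ) {A B : ℕ} (B≤A : B ≤ A) where

  weight≥B : ∀ t → B ≤ weight c A B t
  weight≥B t with c ≤ᵇ t
  ... | true  = B≤A
  ... | false = ≤-refl

  weight≡A : ∀ {t} → c ≤ t → weight c A B t ≡ A
  weight≡A {t} c≤t with c ≤ᵇ t in c≤ᵇt
  ... | true  = refl
  ... | false = contradiction (trans (sym (Equivalence.to Bool.T-≡ (≤⇒≤ᵇ c≤t))) c≤ᵇt) true≢false

  sum-weight≥ : ∀ ts → length ts * B ≤ List.sum (map (weight c A B) ts)
  sum-weight≥ []       = z≤n
  sum-weight≥ (t ∷ ts) = +-mono-≤ (weight≥B t) (sum-weight≥ ts)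

  sum-weight> : ∀ ts → Any (c ≤_) ts → A + length ts * B ≤ B + List.sum (map (weight c A B) ts)
  sum-weight> (t ∷ ts) (Any.here c≤t) = begin
    A + (B + length ts * B)                     ≡⟨ x∙yz≈y∙xz A B _ ⟩
    B + (A + length ts * B)                     ≤⟨ +-monoʳ-≤ B (+-monoʳ-≤ A (sum-weight≥ ts)) ⟩
    B + (A + List.sum (map (weight c A B) ts))  ≡⟨ cong (λ w → B + (w + _)) (weight≡A c≤t) ⟨
    B + List.sum (map (weight c A B) (t ∷ ts))  ∎
    where open ≤-Reasoning
  sum-weight> (t ∷ ts) (Any.there c∈ts) = begin
    A + (B + length ts * B)                     ≡⟨ x∙yz≈y∙xz A B _ ⟩
    B + (A + length ts * B)                     ≤⟨ +-monoʳ-≤ B (sum-weight> ts c∈ts) ⟩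
    B + (B + List.sum (map (weight c A B) ts))  ≤⟨ +-monoʳ-≤ B (+-monoˡ-≤ _ (weight≥B t)) ⟩
    B + List.sum (map (weight c A B) (t ∷ ts))  ∎
    where open ≤-Reasoning

-- Rational approximations B/D < √a ≤ X/D and A/D < √c with n X/D < (n - 1) B/D + A/D:
-- they certify that n copies of √a fall short of (n - 1) copies of √a plus one √c.
record SqrtGap (a c n : ℕ) : Set where
  field
    D A B X : ℕ
    D≢0     : NonZero D
    B≤A     : B ≤ A
    A/D<√c  : A * A < c * (D * D)
    B/D<√a  : B * B < a * (D * D)
    √a≤X/D  : a * (D * D) ≤ X * X
    gap     : n * X + B < n * B + A

SqrtGap⇒¬≤√ : ∀ {a c n} → SqrtGap a c n → ∀ ts → n ≤ length ts → All (a ≤_) ts → Any (c ≤_) ts →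
  ¬ (ts ≤√ replicate n a)
SqrtGap⇒¬≤√ {a} {c} {n} g ts n≤len a≤ts c∈ts ts≤√ =
  let rs′ , rs′<√a , nX<Σrs′ = ts≤√ (scaled (n * X)) (rs , rs<√ts ts a≤ts , nX<Σrs)
  in ℚ.<-irrefl refl (ℚ.<-≤-trans nX<Σrs′ (sumℚ-BelowSqrt-≤ {X} {a} n rs′ √a≤X/D rs′<√a))
  where
  open SqrtGap g
  open Scaled D {{D≢0}}

  w : ℕ → ℕ
  w = weight c A B

  rs : List ℚ
  rs = map (scaled ∘ w) ts

  w/D<√t : ∀ t → a ≤ t → w t * w t < t * (D * D)
  w/D<√t t a≤t with c ≤ᵇ t in c≤ᵇt
  ... | true  = <-≤-trans A/D<√c (*-monoˡ-≤ (D * D) (≤ᵇ⇒≤ c t (Equivalence.from Bool.T-≡ c≤ᵇt)))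
  ... | false = <-≤-trans B/D<√a (*-monoˡ-≤ (D * D) a≤t)

  rs<√ts : ∀ ts → All (a ≤_) ts → Pointwise BelowSqrt ts (map (scaled ∘ w) ts)
  rs<√ts []       []             = []
  rs<√ts (t ∷ ts) (a≤t ∷ a≤ts) = scaled-BelowSqrt {w t} {t} (w/D<√t t a≤t) ∷ rs<√ts ts a≤ts

  nX<Σw : n * X < List.sum (map w ts)
  nX<Σw = +-cancelˡ-< B _ _ (begin-strict
    B + n * X               ≡⟨ +-comm B (n * X) ⟩
    n * X + B               <⟨ gap ⟩
    n * B + A               ≤⟨ +-monoˡ-≤ A (*-monoˡ-≤ B n≤len) ⟩
    length ts * B + A       ≡⟨ +-comm _ A ⟩
    A + length ts * B       ≤⟨ sum-weight> c B≤A ts c∈ts ⟩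
    B + List.sum (map w ts) ∎)
    where open ≤-Reasoning

  nX<Σrs : scaled (n * X) <ℚ sumℚ rs
  nX<Σrs = subst (scaled (n * X) <ℚ_)
    (sym (trans (cong sumℚ (List.map-∘ ts)) (sumℚ-scaled (map w ts))))
    (ℚ.*-monoˡ-<-pos e (ℕtoℚ-mono-< nX<Σw))

-- Solutions of the Pell equation x² = 8y² + 1

pell-step : ∀ x y → x * x ≡ 8 * (y * y) + 1 →
  (3 * x + 8 * y) * (3 * x + 8 * y) ≡ 8 * ((x + 3 * y) * (x + 3 * y)) + 1
pell-step x y x²≡8y²+1 = +-cancelʳ-≡ (8 * (y * y)) _ _ (begin
  (3 * x + 8 * y) * (3 * x + 8 * y) + 8 * (y * y)      ≡⟨ brahmagupta x y ⟩
  8 * ((x + 3 * y) * (x + 3 * y)) + x * x              ≡⟨ cong (z +_) x²≡8y²+1 ⟩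
  8 * ((x + 3 * y) * (x + 3 * y)) + (8 * (y * y) + 1)  ≡⟨ cong (z +_) (+-comm _ 1) ⟩
  8 * ((x + 3 * y) * (x + 3 * y)) + (1 + 8 * (y * y))  ≡⟨ +-assoc z 1 _ ⟨
  8 * ((x + 3 * y) * (x + 3 * y)) + 1 + 8 * (y * y)    ∎)
  where
  open ≡-Reasoning
  z = 8 * ((x + 3 * y) * (x + 3 * y))
  brahmagupta : ∀ x y →
    (3 * x + 8 * y) * (3 * x + 8 * y) + 8 * (y * y) ≡ 8 * ((x + 3 * y) * (x + 3 * y)) + x * x
  brahmagupta = solve-∀

pell-x>0 : ∀ x y → x * x ≡ 8 * (y * y) + 1 → 0 < x
pell-x>0 zero    y x²≡8y²+1 = contradiction (trans (+-comm 1 (8 * (y * y))) (sym x²≡8y²+1)) 1+n≢0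
pell-x>0 (suc x) y _        = s≤s z≤n

pell : ∀ m → ∃ λ x → ∃ λ y → x * x ≡ 8 * (y * y) + 1 × m < y
pell zero    = 3 , 1 , refl , s≤s z≤n
pell (suc m) =
  let x , y , x²≡8y²+1 , m<y = pell m
  in 3 * x + 8 * y , x + 3 * y , pell-step x y x²≡8y²+1 ,
     +-mono-≤ (pell-x>0 x y x²≡8y²+1) (≤-trans m<y (m≤n*m y 3))

-- For a solution with y > n take D = xy, B = 8y², A = 8y² + y and X = x², so that X − B = 1 in units of 1/D.
pell⇒SqrtGap : ∀ {n} x z → x * x ≡ 8 * (suc z * suc z) + 1 → n < suc z → SqrtGap 8 13 n
pell⇒SqrtGap {n} x z x²≡8q+1 n<y = record
  { D = x * y ; A = 8 * q + y ; B = 8 * q ; X = x * x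
  ; D≢0    = >-nonZero (*-mono-≤ (pell-x>0 x y x²≡8q+1) (s≤s z≤n))
  ; B≤A    = m≤m+n (8 * q) y
  ; A/D<√c = begin-strict
      (8 * q + y) * (8 * q + y)                                       <⟨ m<m+n _ (≤-trans (s≤s z≤n) (m≤n+m (12 * q) _)) ⟩
      (8 * q + y) * (8 * q + y) + (8 * q * y * (5 * z + 3) + 12 * q)  ≡⟨ sqrt13-identity z ⟨
      13 * ((8 * q + 1) * q)                                          ≡⟨ cong (13 *_) D²≡ ⟨
      13 * ((x * y) * (x * y))                                        ∎
  ; B/D<√a = begin-strict
      8 * q * (8 * q)            <⟨ m<m+n _ (s≤s z≤n) ⟩
      8 * q * (8 * q) + 8 * q    ≡⟨ sqrt8-identity q ⟨
      8 * ((8 * q + 1) * q)      ≡⟨ cong (8 *_) D²≡ ⟨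
      8 * ((x * y) * (x * y))    ∎
  ; √a≤X/D = begin
      8 * ((x * y) * (x * y))              ≡⟨ cong (8 *_) D²≡ ⟩
      8 * ((8 * q + 1) * q)                ≤⟨ m≤m+n _ _ ⟩
      8 * ((8 * q + 1) * q) + (8 * q + 1)  ≡⟨ pell-square-identity q ⟨
      (8 * q + 1) * (8 * q + 1)            ≡⟨ cong₂ _*_ x²≡8q+1 x²≡8q+1 ⟨
      x * x * (x * x)                      ∎
  ; gap    = begin-strict
      n * (x * x) + 8 * q        ≡⟨ cong (λ x² → n * x² + 8 * q) x²≡8q+1 ⟩
      n * (8 * q + 1) + 8 * q    ≡⟨ gap-identity n q ⟩
      n * (8 * q) + (8 * q + n)  <⟨ +-monoʳ-< (n * (8 * q)) (+-monoʳ-< (8 * q) n<y) ⟩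
      n * (8 * q) + (8 * q + y)  ∎
  }
  where
  open ≤-Reasoning
  y = suc z
  q = y * y

  D²≡ : (x * y) * (x * y) ≡ (8 * q + 1) * q
  D²≡ = trans (square-* x y) (cong (_* q) x²≡8q+1)
    where
    square-* : ∀ x y → (x * y) * (x * y) ≡ (x * x) * (y * y)
    square-* = solve-∀

  sqrt13-identity : ∀ z → let y = suc z; q = y * y in
    13 * ((8 * q + 1) * q) ≡ (8 * q + y) * (8 * q + y) + (8 * q * y * (5 * z + 3) + 12 * q)
  sqrt13-identity = solve-∀

  sqrt8-identity : ∀ q → 8 * ((8 * q + 1) * q) ≡ 8 * q * (8 * q) + 8 * q
  sqrt8-identity = solve-∀

  pell-square-identity : ∀ q → (8 * q + 1) * (8 * q + 1) ≡ 8 * ((8 * q + 1) * q) + (8 * q + 1)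
  pell-square-identity = solve-∀

  gap-identity : ∀ n q → n * (8 * q + 1) + 8 * q ≡ n * (8 * q) + (8 * q + n)
  gap-identity = solve-∀

SqrtGap-8-13 : ∀ n → SqrtGap 8 13 n
SqrtGap-8-13 n with pell n
... | x , suc z , x²≡8y²+1 , n<y = pell⇒SqrtGap x z x²≡8y²+1 n<y

Follows : ∀ n → Fin n → Fin n → Set
Follows n i j = toℕ j ≡ suc (toℕ i) ⊎ (toℕ i ≡ n ∸ 1 × toℕ j ≡ 0)

follows? : ∀ n → Fin n → Fin n → Bool
follows? n i j = (toℕ j ≡ᵇ suc (toℕ i)) ∨ ((toℕ i ≡ᵇ n ∸ 1) ∧ (toℕ j ≡ᵇ 0))

T-follows? : ∀ {i j : Fin n} → T (follows? n i j) ⇔ Follows n i j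
T-follows? {n} {i} {j} = mk⇔ to from
  where
  to : T (follows? n i j) → Follows n i j
  to t with Equivalence.to Bool.T-∨ t
  ... | inj₁ j≡1+i = inj₁ (≡ᵇ⇒≡ _ _ j≡1+i)
  ... | inj₂ wraps =
    let i≡n-1 , j≡0 = Equivalence.to Bool.T-∧ wraps in inj₂ (≡ᵇ⇒≡ _ _ i≡n-1 , ≡ᵇ⇒≡ _ _ j≡0)

  from : Follows n i j → T (follows? n i j)
  from (inj₁ j≡1+i)         = Equivalence.from Bool.T-∨ (inj₁ (≡⇒≡ᵇ _ _ j≡1+i))
  from (inj₂ (i≡n-1 , j≡0)) =
    Equivalence.from Bool.T-∨ (inj₂ (Equivalence.from Bool.T-∧ (≡⇒≡ᵇ _ _ i≡n-1 , ≡⇒≡ᵇ _ _ j≡0)))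

cycleAdj⇔ : ∀ {i j : Fin n} → cycleAdj n i j ≡ true ⇔ (Follows n i j ⊎ Follows n j i)
cycleAdj⇔ = ⇔.trans (⇔.sym Bool.T-≡) (⇔.trans Bool.T-∨ (T-follows? ⊎-⇔ T-follows?))

Follows-functional : ∀ {i j k : Fin n} → Follows n i j → Follows n i k → j ≡ k
Follows-functional (inj₁ j≡1+i) (inj₁ k≡1+i) = Fin.toℕ-injective (trans j≡1+i (sym k≡1+i))
Follows-functional {suc m} {j = j} (inj₁ j≡1+i) (inj₂ (i≡m , _)) =
  contradiction (Fin.toℕ<n j) (<-irrefl (trans j≡1+i (cong suc i≡m)))
Follows-functional {suc m} {k = k} (inj₂ (i≡m , _)) (inj₁ k≡1+i) =
  contradiction (Fin.toℕ<n k) (<-irrefl (trans k≡1+i (cong suc i≡m)))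
Follows-functional (inj₂ (_ , j≡0)) (inj₂ (_ , k≡0)) = Fin.toℕ-injective (trans j≡0 (sym k≡0))

Follows-injective : ∀ {i j k : Fin n} → Follows n i k → Follows n j k → i ≡ j
Follows-injective (inj₁ k≡1+i) (inj₁ k≡1+j) = Fin.toℕ-injective (suc-injective (trans (sym k≡1+i) k≡1+j))
Follows-injective (inj₁ k≡1+i) (inj₂ (_ , k≡0)) = contradiction (trans (sym k≡1+i) k≡0) 1+n≢0
Follows-injective (inj₂ (_ , k≡0)) (inj₁ k≡1+j) = contradiction (trans (sym k≡1+j) k≡0) 1+n≢0
Follows-injective (inj₂ (i≡n-1 , _)) (inj₂ (j≡n-1 , _)) = Fin.toℕ-injective (trans i≡n-1 (sym j≡n-1))

Follows-asym : 3 ≤ n → ∀ {i j : Fin n} → Follows n i j → Follows n j i → ⊥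
Follows-asym _ (inj₁ j≡1+i) (inj₁ i≡1+j) = <-irrefl (trans i≡1+j (cong suc j≡1+i)) (n≤1+n _)
Follows-asym (s≤s (s≤s (s≤s _))) (inj₁ j≡1+i) (inj₂ (j≡n-1 , i≡0)) =
  contradiction (trans (sym j≡n-1) (trans j≡1+i (cong suc i≡0))) λ ()
Follows-asym (s≤s (s≤s (s≤s _))) (inj₂ (i≡n-1 , j≡0)) (inj₁ i≡1+j) =
  contradiction (trans (sym i≡n-1) (trans i≡1+j (cong suc j≡0))) λ ()
Follows-asym (s≤s (s≤s (s≤s _))) (inj₂ (i≡n-1 , j≡0)) (inj₂ (_ , i≡0)) =
  contradiction (trans (sym i≡n-1) i≡0) λ ()

next : (i : Fin n) → ∃ (Follows n i)
next {suc m} i with m≤n⇒m<n∨m≡n (Fin.toℕ<n i)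
... | inj₁ 1+i<n = fromℕ< 1+i<n , inj₁ (Fin.toℕ-fromℕ< 1+i<n)
... | inj₂ 1+i≡n = zero , inj₂ (suc-injective 1+i≡n , refl)

prev : (i : Fin n) → ∃ λ h → Follows n h i
prev {suc m} i with toℕ i in i≡
... | zero  = Fin.fromℕ m , inj₂ (Fin.toℕ-fromℕ m , refl)
... | suc k = fromℕ< k<n , inj₁ (cong suc (sym (Fin.toℕ-fromℕ< k<n)))
  where
  k<n : k < suc m
  k<n = <-trans (n<1+n k) (subst (_< suc m) i≡ (Fin.toℕ<n i))

cycle-2-regular : 3 ≤ n → ∀ i → count (cycleAdj n i) ≡ 2
cycle-2-regular {n} n≥3 i =
  count≡2 (cycleAdj n i) (Equivalence.from cycleAdj⇔ (inj₁ i→j)) (Equivalence.from cycleAdj⇔ (inj₂ h→i))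
    (λ j≡h → Follows-asym n≥3 i→j (subst (λ x → Follows n x i) (sym j≡h) h→i))
    λ k i~k → Data.Sum.map (λ i→k → Follows-functional i→k i→j) (λ k→i → Follows-injective k→i h→i)
                           (Equivalence.to cycleAdj⇔ i~k)
  where
  i→j = proj₂ (next i)
  h→i = proj₂ (prev i)

-- Connected 2-regular graphs are cycles

module _ {P : ℕ → Set} (P? : ∀ k → Dec (P k)) where

  private
    search : ∀ m → (∃ λ k → P k × k ≤ m × (∀ {j} → j < k → ¬ P j)) ⊎ (∀ {j} → j ≤ m → ¬ P j)
    search zero with P? 0
    ... | yes P0 = inj₁ (0 , P0 , z≤n , λ ())
    ... | no ¬P0 = inj₂ λ { z≤n → ¬P0 }
    search (suc m) with search m
    ... | inj₁ (k , Pk , k≤m , below) = inj₁ (k , Pk , m≤n⇒m≤1+n k≤m , below)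
    ... | inj₂ none with P? (suc m)
    ...   | yes P1+m = inj₁ (suc m , P1+m , ≤-refl , λ j<1+m → none (≤-pred j<1+m))
    ...   | no ¬P1+m = inj₂ λ j≤1+m →
      [ (λ j<1+m → none (≤-pred j<1+m)) , (λ { refl → ¬P1+m }) ]′ (m≤n⇒m<n∨m≡n j≤1+m)

  least : ∀ {m} → P m → ∃ λ k → P k × k ≤ m × (∀ {j} → j < k → ¬ P j)
  least {m} Pm with search m
  ... | inj₁ found = found
  ... | inj₂ none  = contradiction Pm (none ≤-refl)

module ConnectedTwoRegular {n} (G : SimpleGraph n) (n≥3 : 3 ≤ n) (conn : Connected G)
                           (deg≡2 : ∀ u → deg G u ≡ 2) where

  _~_ : Fin n → Fin n → Set
  u ~ w = adj G u w ≡ true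

  count-adj≡2 : ∀ u → count (adj G u) ≡ 2
  count-adj≡2 u = trans (sym (deg≡count G u)) (deg≡2 u)

  neighbours : ∀ u → ∃ λ a → ∃ λ b → u ~ a × u ~ b × a ≢ b
  neighbours u = count≥2⇒∃₂ (adj G u) (≤-reflexive (sym (count-adj≡2 u)))

  other : Fin n → Fin n → Fin n
  other u p with p Fin.≟ proj₁ (neighbours u)
  ... | yes _ = proj₁ (proj₂ (neighbours u))
  ... | no  _ = proj₁ (neighbours u)

  other-adj : ∀ u p → u ~ other u p
  other-adj u p with p Fin.≟ proj₁ (neighbours u)
  ... | yes _ = proj₁ (proj₂ (proj₂ (proj₂ (neighbours u))))
  ... | no  _ = proj₁ (proj₂ (proj₂ (neighbours u)))

  other-≢ : ∀ u p → other u p ≢ p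
  other-≢ u p with p Fin.≟ proj₁ (neighbours u)
  ... | yes p≡a = λ b≡p → proj₂ (proj₂ (proj₂ (proj₂ (neighbours u)))) (trans (sym p≡a) (sym b≡p))
  ... | no  p≢a = λ a≡p → p≢a (sym a≡p)

  neighbour-cases : ∀ u {p w} → u ~ p → u ~ w → w ≡ p ⊎ w ≡ other u p
  neighbour-cases u {p} u~p =
    count≡2⇒covered (adj G u) (count-adj≡2 u) u~p (other-adj u p) (other-≢ u p ∘ sym)

  ~-sym : ∀ {u w} → u ~ w → w ~ u
  ~-sym = adj-sym-true G

  start : Fin n
  start = fromℕ< {0} (≤-trans (s≤s z≤n) n≥3)

  -- Consecutive pairs (v k , v (k + 1)) of the walk from start that never turns back.
  steps : ℕ → Fin n × Fin n
  steps zero    = start , proj₁ (neighbours start)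
  steps (suc k) = proj₂ (steps k) , other (proj₂ (steps k)) (proj₁ (steps k))

  v : ℕ → Fin n
  v k = proj₁ (steps k)

  v-adj : ∀ k → v k ~ v (suc k)
  v-adj zero    = proj₁ (proj₂ (proj₂ (neighbours start)))
  v-adj (suc k) = other-adj (v (suc k)) (v k)

  v-no-backtrack : ∀ k → v (2 + k) ≢ v k
  v-no-backtrack k = other-≢ (v (suc k)) (v k)

  v-neighbours : ∀ k {w} → v (suc k) ~ w → w ≡ v k ⊎ w ≡ v (2 + k)
  v-neighbours k = neighbour-cases (v (suc k)) (~-sym (v-adj k))

  -- Reading the walk backwards from a repetition v i = v j (i < j) leads back to start.
  repeat⇒return : ∀ j i → i < j → v i ≡ v j → ∃ λ d → 0 < d × d ≤ j × v d ≡ v 0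
  repeat⇒return j zero i<j v0≡vj = j , i<j , ≤-refl , sym v0≡vj
  repeat⇒return (suc j) (suc i) (s≤s i<j) vi+1≡vj+1
    with v-neighbours j (subst (_~ v i) vi+1≡vj+1 (~-sym (v-adj i)))
  ... | inj₁ vi≡vj =
    let d , d>0 , d≤j , vd≡v0 = repeat⇒return j i i<j vi≡vj in d , d>0 , m≤n⇒m≤1+n d≤j , vd≡v0
  ... | inj₂ vi≡vj+2 with v-neighbours j (subst (_~ v (2 + i)) vi+1≡vj+1 (v-adj (suc i)))
  ...   | inj₂ vi+2≡vj+2 = contradiction (trans vi+2≡vj+2 (sym vi≡vj+2)) (v-no-backtrack i)
  ...   | inj₁ vi+2≡vj with <-cmp (2 + i) j
  ...     | tri< i+2<j _ _ =
    let d , d>0 , d≤j , vd≡v0 = repeat⇒return j (2 + i) i+2<j vi+2≡vj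
    in d , d>0 , m≤n⇒m≤1+n d≤j , vd≡v0
  ...     | tri≈ _ refl _ = contradiction (sym vi+1≡vj+1) (v-no-backtrack (suc i))
  ...     | tri> _ _ i+2>j with ≤-antisym i<j (≤-pred i+2>j)
  ...       | refl = contradiction vi+1≡vj+1 (adj⇒≢ G (v-adj (suc i)))

  Returns : ℕ → Set
  Returns d = 0 < d × v d ≡ v 0

  returns : ∃ λ d → Returns d × d ≤ n
  returns with Fin.pigeonhole (n<1+n n) (λ (k : Fin (suc n)) → v (toℕ k))
  ... | i , j , i<j , vi≡vj =
    let d , d>0 , d≤j , vd≡v0 = repeat⇒return (toℕ j) (toℕ i) i<j vi≡vj
    in d , (d>0 , vd≡v0) , ≤-trans d≤j (≤-pred (Fin.toℕ<n j))

  private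
    least-return = least (λ d → (0 <? d) ×-dec (v d Fin.≟ v 0)) (proj₁ (proj₂ returns))

  period : ℕ
  period = proj₁ least-return

  period>0 : 0 < period
  period>0 = proj₁ (proj₁ (proj₂ least-return))

  v-period : v period ≡ v 0
  v-period = proj₂ (proj₁ (proj₂ least-return))

  period≤n : period ≤ n
  period≤n = ≤-trans (proj₁ (proj₂ (proj₂ least-return))) (proj₂ (proj₂ returns))

  period-least : ∀ {d} → d < period → ¬ Returns d
  period-least = proj₂ (proj₂ (proj₂ least-return))

  v-injective : ∀ {i j} → i < period → j < period → v i ≡ v j → i ≡ j
  v-injective {i} {j} i<p j<p vi≡vj with <-cmp i j
  ... | tri≈ _ i≡j _ = i≡j
  ... | tri< i<j _ _ =
    let d , d>0 , d≤j , vd≡v0 = repeat⇒return j i i<j vi≡vj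
    in contradiction (d>0 , vd≡v0) (period-least (≤-<-trans d≤j j<p))
  ... | tri> _ _ j<i =
    let d , d>0 , d≤i , vd≡v0 = repeat⇒return i j j<i (sym vi≡vj)
    in contradiction (d>0 , vd≡v0) (period-least (≤-<-trans d≤i i<p))

  period≥3 : 3 ≤ period
  period≥3 with period | period>0 | v-period
  ... | suc zero          | _ | v1≡v0 = contradiction (sym v1≡v0) (adj⇒≢ G (v-adj 0))
  ... | suc (suc zero)    | _ | v2≡v0 = contradiction v2≡v0 (v-no-backtrack 0)
  ... | suc (suc (suc _)) | _ | _     = s≤s (s≤s (s≤s z≤n))

  last : ℕ
  last = period ∸ 1

  1+last≡period : suc last ≡ period
  1+last≡period = m+[n∸m]≡n period>0

  last<period : last < period
  last<period = subst (last <_) 1+last≡period (n<1+n last)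

  v-last-adj : v last ~ v 0
  v-last-adj = subst (v last ~_) (trans (cong v 1+last≡period) v-period) (v-adj last)

  start-neighbours : ∀ {w} → v 0 ~ w → w ≡ v 1 ⊎ w ≡ v last
  start-neighbours = count≡2⇒covered (adj G (v 0)) (count-adj≡2 (v 0)) (v-adj 0) (~-sym v-last-adj) v1≢vlast
    where
    v1≢vlast : v 1 ≢ v last
    v1≢vlast v1≡vlast = <-irrefl
      (trans (cong suc (v-injective (≤-trans (s≤s (s≤s z≤n)) period≥3) last<period v1≡vlast)) 1+last≡period)
      period≥3

  OnWalk : Fin n → Set
  OnWalk u = ∃ λ k → k < period × u ≡ v k

  OnWalk-closed : ∀ {k w} → k < period → v k ~ w → OnWalk w
  OnWalk-closed {zero} _ v0~w =
    [ (λ w≡v1 → 1 , ≤-trans (s≤s (s≤s z≤n)) period≥3 , w≡v1) , (λ w≡vlast → last , last<period , w≡vlast) ]′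
      (start-neighbours v0~w)
  OnWalk-closed {suc k} 1+k<p vk+1~w with v-neighbours k vk+1~w
  ... | inj₁ w≡vk = k , <-trans (n<1+n k) 1+k<p , w≡vk
  ... | inj₂ w≡vk+2 with m≤n⇒m<n∨m≡n 1+k<p
  ...   | inj₁ 2+k<p = 2 + k , 2+k<p , w≡vk+2
  ...   | inj₂ 2+k≡p = 0 , period>0 , trans w≡vk+2 (trans (cong v 2+k≡p) v-period)

  walk-OnWalk : ∀ {x u} → Walk (adj G) x u → OnWalk x → OnWalk u
  walk-OnWalk here               x∈v          = x∈v
  walk-OnWalk (step x~w w⇝u) (k , k<p , refl) = walk-OnWalk w⇝u (OnWalk-closed k<p x~w)

  index : Fin n → ℕ
  index u = proj₁ (walk-OnWalk (conn (v 0) u) (0 , period>0 , refl))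

  index<period : ∀ u → index u < period
  index<period u = proj₁ (proj₂ (walk-OnWalk (conn (v 0) u) (0 , period>0 , refl)))

  v-index : ∀ u → v (index u) ≡ u
  v-index u = sym (proj₂ (proj₂ (walk-OnWalk (conn (v 0) u) (0 , period>0 , refl))))

  period≡n : period ≡ n
  period≡n with m≤n⇒m<n∨m≡n period≤n
  ... | inj₂ p≡n = p≡n
  ... | inj₁ p<n with Fin.pigeonhole p<n (λ u → fromℕ< (index<period u))
  ... | u₁ , u₂ , u₁<u₂ , same = contradiction
    (trans (sym (v-index u₁)) (trans (cong v index-same) (v-index u₂))) (Fin.<⇒≢ u₁<u₂)
    where
    index-same : index u₁ ≡ index u₂
    index-same = trans (sym (Fin.toℕ-fromℕ< (index<period u₁)))
                   (trans (cong toℕ same) (Fin.toℕ-fromℕ< (index<period u₂)))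

  vertex : Fin n → Fin n
  vertex k = v (toℕ k)

  position : Fin n → Fin n
  position u = fromℕ< (subst (index u <_) period≡n (index<period u))

  vertex-position : ∀ u → vertex (position u) ≡ u
  vertex-position u = trans (cong v (Fin.toℕ-fromℕ< (subst (index u <_) period≡n (index<period u)))) (v-index u)

  vertex-injective : ∀ {a b} → vertex a ≡ vertex b → a ≡ b
  vertex-injective {a} {b} = Fin.toℕ-injective ∘ v-injective (toℕ<period a) (toℕ<period b)
    where
    toℕ<period : ∀ k → toℕ k < period
    toℕ<period k = subst (toℕ k <_) (sym period≡n) (Fin.toℕ<n k)

  position-vertex : ∀ k → position (vertex k) ≡ k
  position-vertex k = vertex-injective (vertex-position (vertex k))

  follows⇒adj : ∀ {a b} → Follows n a b → vertex a ~ vertex b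
  follows⇒adj {a} (inj₁ b≡1+a) = subst (λ k → vertex a ~ v k) (sym b≡1+a) (v-adj (toℕ a))
  follows⇒adj (inj₂ (a≡n-1 , b≡0)) =
    subst₂ (λ i j → v i ~ v j) (sym (trans a≡n-1 (cong (_∸ 1) (sym period≡n)))) (sym b≡0) v-last-adj

  adj⇒follows : ∀ {a b} → vertex a ~ vertex b → Follows n a b ⊎ Follows n b a
  adj⇒follows {a} {b} va~vb =
    Data.Sum.map (λ vb≡vj → subst (Follows n a) (sym (vertex-injective vb≡vj)) a→j)
                 (λ vb≡vh → subst (λ x → Follows n x a) (sym (vertex-injective vb≡vh)) h→a)
                 (count≡2⇒covered (adj G (vertex a)) (count-adj≡2 (vertex a))
                   (follows⇒adj a→j) (~-sym (follows⇒adj h→a)) vj≢vh va~vb)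
    where
    a→j = proj₂ (next a)
    h→a = proj₂ (prev a)
    vj≢vh : vertex (proj₁ (next a)) ≢ vertex (proj₁ (prev a))
    vj≢vh vj≡vh = Follows-asym n≥3 a→j (subst (λ x → Follows n x a) (sym (vertex-injective vj≡vh)) h→a)

  adj≡cycleAdj : ∀ a b → adj G (vertex a) (vertex b) ≡ cycleAdj n a b
  adj≡cycleAdj a b = ≡true⇔⇒≡
    (Equivalence.from cycleAdj⇔ ∘ adj⇒follows {a} {b})
    ([ follows⇒adj {a} {b} , ~-sym ∘ follows⇒adj {b} {a} ]′ ∘ Equivalence.to cycleAdj⇔)

  isoToCycle : IsoToCycle G
  isoToCycle = mk↔ₛ′ position vertex position-vertex vertex-position , λ i j →
    trans (cong₂ (adj G) (sym (vertex-position i)) (sym (vertex-position j)))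
          (adj≡cycleAdj (position i) (position j))

IsoToCycle⇒deg≡2 : 3 ≤ n → (G : SimpleGraph n) → IsoToCycle G → ∀ u → deg G u ≡ 2
IsoToCycle⇒deg≡2 {n} n≥3 G (π , adj≡cycleAdj) u = begin
  deg G u                                             ≡⟨ deg≡count G u ⟩
  count (adj G u)                                     ≡⟨ count-cong (adj≡cycleAdj u) ⟩
  count (cycleAdj n (Inverse.to π u) ∘ Inverse.to π)  ≡⟨ count-permute (cycleAdj n (Inverse.to π u)) π ⟩
  count (cycleAdj n (Inverse.to π u))                 ≡⟨ cycle-2-regular n≥3 (Inverse.to π u) ⟩
  2                                                   ∎
  where open ≡-Reasoning

All-≡⇒replicate : ∀ {A : Set} {a : A} xs → All (_≡ a) xs → xs ≡ replicate (length xs) a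
All-≡⇒replicate []       []            = refl
All-≡⇒replicate (x ∷ xs) (refl ∷ xs≡a) = cong (x ∷_) (All-≡⇒replicate xs xs≡a)

module _ (G : SimpleGraph n) (deg≥2 : ∀ u → 2 ≤ deg G u) where

  radicands≥8 : All (8 ≤_) (somborTerms G)
  radicands≥8 = All-somborTerms G (8 ≤_) λ {u} {v} _ →
    +-mono-≤ (*-mono-≤ (deg≥2 u) (deg≥2 u)) (*-mono-≤ (deg≥2 v) (deg≥2 v))

  deg≥3⇒radicand≥13 : ∀ u → 3 ≤ deg G u → Any (13 ≤_) (somborTerms G)
  deg≥3⇒radicand≥13 u deg≥3 =
    let w , u~w = count>0⇒∃ (adj G u) (subst (0 <_) (deg≡count G u) (≤-trans (s≤s z≤n) deg≥3))
    in Any-somborTerms G (13 ≤_) u~w (+-mono-≤ (*-mono-≤ deg≥3 deg≥3) (*-mono-≤ (deg≥2 w) (deg≥2 w)))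

  sqrt8Times≤SO : sqrt8Times n ≤√ somborTerms G
  sqrt8Times≤SO = replicate-≤√ n (somborTerms G) (s≤s z≤n) (order≤size G deg≥2) radicands≥8

  SO≤sqrt8Times⇒2-regular : somborTerms G ≤√ sqrt8Times n → ∀ u → deg G u ≡ 2
  SO≤sqrt8Times⇒2-regular SO≤ u with m≤n⇒m<n∨m≡n (deg≥2 u)
  ... | inj₂ 2≡deg = sym 2≡deg
  ... | inj₁ deg≥3 = contradiction SO≤
    (SqrtGap⇒¬≤√ (SqrtGap-8-13 n) (somborTerms G) (order≤size G deg≥2) radicands≥8 (deg≥3⇒radicand≥13 u deg≥3))

2-regular⇒SO≡sqrt8Times : (G : SimpleGraph n) → (∀ u → deg G u ≡ 2) → somborTerms G ≡ sqrt8Times n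
2-regular⇒SO≡sqrt8Times {n} G deg≡2 = begin
  somborTerms G                             ≡⟨ All-≡⇒replicate _ radicands≡8 ⟩
  replicate (length (somborTerms G)) 8      ≡⟨ cong (λ k → replicate k 8) (size≡order G deg≡2) ⟩
  replicate n 8                             ∎
  where
  open ≡-Reasoning
  radicands≡8 : All (_≡ 8) (somborTerms G)
  radicands≡8 = All-somborTerms G (_≡ 8) λ {u} {v} _ → cong₂ (λ a b → a * a + b * b) (deg≡2 u) (deg≡2 v)

theorem4p1 : (n : ℕ) → n ≥ 3 → (G : SimpleGraph n) → Connected G → NoBridges G →
    (sqrt8Times n ≤√ somborTerms G) × ((somborTerms G ≈√ sqrt8Times n) ⇔ IsoToCycle G)
theorem4p1 n n≥3 G conn bridgeless = sqrt8Times≤SO G deg≥2 , mk⇔ equal⇒cycle cycle⇒equal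
  where
  deg≥2 : ∀ u → 2 ≤ deg G u
  deg≥2 = bridgeless⇒deg≥2 (≤-trans (n≤1+n 2) n≥3) G conn bridgeless

  equal⇒cycle : somborTerms G ≈√ sqrt8Times n → IsoToCycle G
  equal⇒cycle (SO≤ , _) = ConnectedTwoRegular.isoToCycle G n≥3 conn (SO≤sqrt8Times⇒2-regular G deg≥2 SO≤)

  cycle⇒equal : IsoToCycle G → somborTerms G ≈√ sqrt8Times n
  cycle⇒equal iso rewrite 2-regular⇒SO≡sqrt8Times G (IsoToCycle⇒deg≡2 n≥3 G iso) = (λ _ → id) , (λ _ → id)
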